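{- Let $\Sigma$ be a nonempty set, $\Omega\subset\Sigma$ a nonempty subset, and let $f:\Sigma^n\to\Sigma$ be a reducible $n$-quasigroup such that $f|_{\Omega^n}$ is an $n$-quasigroup $\Omega^n\to\Omega$. Then $f|_{\Omega^n}$ is a reducible $n$-quasigroup.
   Context: For a nonempty set $\Sigma$ and a positive integer $n$, an $n$-ary operation $f:\Sigma^n\to\Sigma$ is an $n$-quasigroup if in the equality $z_0=f(z_1,\ldots,z_n)$ knowledge of any $n$ of the elements $z_0,\ldots,z_n$ uniquely specifies the remaining one. An $n$-quasigroup $f$ on $\Sigma$ is reducible if there exist an integer $k$ with $1<k<n$, a permutation $\sigma$ of $\{1,\ldots,n\}$, an $(n-k+1)$-quasigroup $h$ and a $k$-quasigroup $g$ on $\Sigma$ such that $f(x_1,\ldots,x_n)=h\big(g(x_{\sigma(1)},\ldots,x_{\sigma(k)}),x_{\sigma(k+1)},\ldots,x_{\sigma(n)}\big)$ identically. (Reducibility of $f|_{\Omega^n}$ is meant with $h,g$ being quasigroups on $\Omega$.) -}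

module Defs where

open import Level using (Level)
open import Data.Nat using (ℕ; suc; _+_; _≤_; _<_)
open import Data.Fin using (Fin; cast)
open import Data.Fin.Permutation using (Permutation′; _⟨$⟩ʳ_)
open import Data.Vec using (Vec; _∷_; lookup; tabulate; take; drop; _[_]≔_)
open import Data.Product using (Σ; ∃; ∃-syntax; _×_; _,_)
open import Relation.Binary.PropositionalEquality using (_≡_)

private variable ℓ : Level

Op : ∀ {ℓ} → ℕ → Set ℓ → Set ℓ
Op n A = Vec A n → A

-- n-quasigroup: in z₀ = f(z₁,…,zₙ), any n of z₀,…,zₙ determine the remaining one.
-- z₀ is determined by z₁..zₙ automatically (f is a function); the remaining
-- condition: for every position i, every choice of the other arguments and every z₀,
-- there is exactly one value y at position i with f(…,y,…) = z₀.
IsQuasigroup : ∀ {A : Set ℓ} (n : ℕ) → Op n A → Set ℓ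
IsQuasigroup {A = A} n f =
  ∀ (i : Fin n) (xs : Vec A n) (z₀ : A) →
    (∃[ y ] f (xs [ i ]≔ y) ≡ z₀) ×
    (∀ y y′ → f (xs [ i ]≔ y) ≡ z₀ → f (xs [ i ]≔ y′) ≡ z₀ → y ≡ y′)

-- Reducible: n = k + m with 1 < k < n (i.e. 2 ≤ k, 1 ≤ m), a permutation σ of the
-- n positions, a k-quasigroup g and an (m+1) = (n-k+1)-quasigroup h with
-- f(x₁,…,xₙ) = h(g(x_σ(1),…,x_σ(k)), x_σ(k+1),…,x_σ(n)).
Reducible : ∀ {A : Set ℓ} (n : ℕ) → Op n A → Set ℓ
Reducible {A = A} n f =
  Σ ℕ λ k → Σ ℕ λ m → Σ (k + m ≡ n) λ eq →
    (2 ≤ k) × (1 ≤ m) ×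
    Σ (Permutation′ n) λ σ →
    Σ (Op k A) λ g → Σ (Op (suc m) A) λ h →
      IsQuasigroup k g × IsQuasigroup (suc m) h ×
      (∀ (xs : Vec A n) →
        let ys : Vec A (k + m)
            ys = tabulate (λ j → lookup xs (σ ⟨$⟩ʳ cast eq j))
        in f xs ≡ h (g (take k ys) ∷ drop k ys))

-- A decomposition f = h(g(prefix), suffix) is visible in f alone: since h is injective in
-- its first argument, two prefixes u, u′ have the same g-value iff f(u, w) = f(u′, w) for
-- one (equivalently, every) suffix w. This criterion passes to the restriction fΩ, as Ω
-- embeds injectively into Σ. Hence fΩ decomposes with gΩ(u) := fΩ(u, c) for a constant
-- suffix c and hΩ(z, w) := fΩ(s(z), w) for a section s of gΩ; both are quasigroups, since
-- fixing some arguments of a quasigroup leaves a quasigroup.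
module Submission where

open import Defs
open import Level using (Level)
open import Data.Nat using (ℕ; suc; _+_)
open import Data.Fin using (Fin; zero; suc; _↑ˡ_; _↑ʳ_; _≟_)
open import Data.Fin.Permutation using (Permutation; _⟨$⟩ʳ_; _⟨$⟩ˡ_; inverseˡ; inverseʳ; flip; cast-id; _∘ₚ_)
open import Data.Vec using (Vec; map; _∷_; _++_; take; drop; lookup; tabulate; replicate; _[_]≔_)
open import Data.Vec.Properties using (take++drop≡id; ++-injective; map-++; lookup-map; lookup∘tabulate; tabulate-∘; tabulate-cong; lookup∘update; lookup∘update′; []≔-++-↑ˡ; []≔-++-↑ʳ)
open import Data.Vec.Relation.Binary.Pointwise.Extensional using (ext; Pointwise-≡⇒≡)
open import Data.Product using (Σ; ∃-syntax; _×_; _,_; proj₁; proj₂)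
open import Function using (_∘_)
open import Function.Definitions using (Injective)
open import Relation.Binary.PropositionalEquality using (_≡_; _≢_; refl; sym; trans; cong; cong₂; module ≡-Reasoning)
open import Relation.Nullary using (yes; no)

private variable
  ℓ : Level
  A B : Set ℓ
  k m n p : ℕ

reindex : Permutation p n → Vec A n → Vec A p
reindex π xs = tabulate (λ j → lookup xs (π ⟨$⟩ʳ j))

reindex-flip : (π : Permutation p n) (ys : Vec A p) → reindex π (reindex (flip π) ys) ≡ ys
reindex-flip π ys = Pointwise-≡⇒≡ (ext λ j → begin
  lookup (reindex π (reindex (flip π) ys)) j  ≡⟨ lookup∘tabulate _ j ⟩
  lookup (reindex (flip π) ys) (π ⟨$⟩ʳ j)     ≡⟨ lookup∘tabulate _ (π ⟨$⟩ʳ j) ⟩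
  lookup ys (π ⟨$⟩ˡ (π ⟨$⟩ʳ j))               ≡⟨ cong (lookup ys) (inverseˡ π) ⟩
  lookup ys j                                 ∎)
  where open ≡-Reasoning

map-reindex : (f : A → B) (π : Permutation p n) (xs : Vec A n) →
  map f (reindex π xs) ≡ reindex π (map f xs)
map-reindex f π xs = trans (sym (tabulate-∘ f _)) (tabulate-cong λ j → sym (lookup-map _ f xs))

reindex-transpose : {F : Vec A n → B} {H : Vec A p → B} (π : Permutation p n) →
  (∀ xs → F xs ≡ H (reindex π xs)) → ∀ ys → F (reindex (flip π) ys) ≡ H ys
reindex-transpose {H = H} π F≡H ys = trans (F≡H _) (cong H (reindex-flip π ys))

reindex-update : (π : Permutation p n) (xs : Vec A n) (i : Fin n) (y : A) →
  reindex π (xs [ i ]≔ y) ≡ reindex π xs [ π ⟨$⟩ˡ i ]≔ y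
reindex-update π xs i y = Pointwise-≡⇒≡ (ext pointwise)
  where
  pointwise : ∀ j → lookup (reindex π (xs [ i ]≔ y)) j ≡ lookup (reindex π xs [ π ⟨$⟩ˡ i ]≔ y) j
  pointwise j with j ≟ π ⟨$⟩ˡ i
  ... | yes refl = trans (lookup∘tabulate _ j) (trans (cong (lookup (xs [ i ]≔ y)) (inverseʳ π))
                     (trans (lookup∘update i xs y) (sym (lookup∘update j (reindex π xs) y))))
  ... | no j≢π⁻¹i = trans (lookup∘tabulate _ j) (trans (lookup∘update′ πj≢i xs y)
                      (trans (sym (lookup∘tabulate _ j)) (sym (lookup∘update′ j≢π⁻¹i (reindex π xs) y))))
    where
    πj≢i : π ⟨$⟩ʳ j ≢ i
    πj≢i πj≡i = j≢π⁻¹i (trans (sym (inverseˡ π)) (cong (π ⟨$⟩ˡ_) πj≡i))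

isQuasigroup-∘ : {F : Op n A} (φ : Vec A p → Vec A n) (τ : Fin p → Fin n) →
  (∀ xs i y → φ (xs [ i ]≔ y) ≡ φ xs [ τ i ]≔ y) →
  IsQuasigroup n F → IsQuasigroup p (F ∘ φ)
isQuasigroup-∘ {F = F} φ τ φ-update F-quasi i xs z =
  (y , trans (moved y) Fy≡z) ,
  λ y y′ e e′ → unique y y′ (trans (sym (moved y)) e) (trans (sym (moved y′)) e′)
  where
  y = proj₁ (proj₁ (F-quasi (τ i) (φ xs) z))
  Fy≡z = proj₂ (proj₁ (F-quasi (τ i) (φ xs) z))
  unique = proj₂ (F-quasi (τ i) (φ xs) z)
  moved : ∀ y → F (φ (xs [ i ]≔ y)) ≡ F (φ xs [ τ i ]≔ y)
  moved y = cong F (φ-update xs i y)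

isQuasigroup-++ˡ : {G : Op (p + m) A} → IsQuasigroup (p + m) G → (w : Vec A m) →
  IsQuasigroup p (λ u → G (u ++ w))
isQuasigroup-++ˡ {m = m} {G = G} G-quasi w =
  isQuasigroup-∘ {F = G} (_++ w) (_↑ˡ m) (λ u i y → sym ([]≔-++-↑ˡ u w i)) G-quasi

isQuasigroup-++ʳ : {G : Op (p + m) A} → IsQuasigroup (p + m) G → (u : Vec A p) →
  IsQuasigroup m (λ w → G (u ++ w))
isQuasigroup-++ʳ {p = p} {G = G} G-quasi u =
  isQuasigroup-∘ {F = G} (u ++_) (p ↑ʳ_) (λ w j y → sym ([]≔-++-↑ʳ u w j)) G-quasi

isQuasigroup-reindex : {F : Op n A} (π : Permutation p n) →
  IsQuasigroup n F → IsQuasigroup p (F ∘ reindex (flip π))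
isQuasigroup-reindex {F = F} π =
  isQuasigroup-∘ {F = F} (reindex (flip π)) (π ⟨$⟩ʳ_) (reindex-update (flip π))

isQuasigroup⇒injective : {F : Op n A} → IsQuasigroup n F → ∀ i xs →
  Injective _≡_ _≡_ (λ y → F (xs [ i ]≔ y))
isQuasigroup⇒injective {F = F} F-quasi i xs {y} {y′} e =
  proj₂ (F-quasi i xs (F (xs [ i ]≔ y))) y y′ refl (sym e)

isQuasigroup⇒surjective : {F : Op (suc n) A} → IsQuasigroup (suc n) F → A →
  ∀ z → ∃[ xs ] F xs ≡ z
isQuasigroup⇒surjective {n = n} F-quasi a z with F-quasi zero (replicate (suc n) a) z
... | (y , e) , _ = _ , e

PrefixCongruent : ∀ k → Op (k + m) A → Set _
PrefixCongruent {m = m} {A = A} k G =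
  ∀ (u u′ : Vec A k) (w w′ : Vec A m) → G (u ++ w) ≡ G (u′ ++ w) → G (u ++ w′) ≡ G (u′ ++ w′)

Decomposition : ∀ k m → Op (k + m) A → Set _
Decomposition {A = A} k m G = Σ (Op k A) λ g → Σ (Op (suc m) A) λ h →
  IsQuasigroup k g × IsQuasigroup (suc m) h × (∀ ys → G ys ≡ h (g (take k ys) ∷ drop k ys))

decomposition-++ : ∀ k {F : Op (k + m) A} {g : Op k A} {h : Op (suc m) A} →
  (∀ ys → F ys ≡ h (g (take k ys) ∷ drop k ys)) → ∀ u w → F (u ++ w) ≡ h (g u ∷ w)
decomposition-++ k {g = g} {h = h} F≡hg u w =
  trans (F≡hg (u ++ w)) (cong₂ (λ a b → h (g a ∷ b)) take≡u drop≡w)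
  where
  take≡u×drop≡w = ++-injective (take k (u ++ w)) u (take++drop≡id k (u ++ w))
  take≡u = proj₁ take≡u×drop≡w
  drop≡w = proj₂ take≡u×drop≡w

prefixCongruent-restrict : {S O : Set ℓ} (ι : O → S) → Injective _≡_ _≡_ ι →
  {G : Op (k + m) O} (g : Op k S) {h : Op (suc m) S} → IsQuasigroup (suc m) h →
  (∀ u w → ι (G (u ++ w)) ≡ h (g (map ι u) ∷ map ι w)) → PrefixCongruent k G
prefixCongruent-restrict ι ι-inj {G} g {h} h-quasi lift u u′ w w′ e = ι-inj (begin
  ι (G (u ++ w′))               ≡⟨ lift u w′ ⟩
  h (g (map ι u) ∷ map ι w′)    ≡⟨ cong (λ a → h (a ∷ map ι w′)) same-g ⟩
  h (g (map ι u′) ∷ map ι w′)   ≡⟨ lift u′ w′ ⟨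
  ι (G (u′ ++ w′))              ∎)
  where
  open ≡-Reasoning
  same-g : g (map ι u) ≡ g (map ι u′)
  same-g = isQuasigroup⇒injective {F = h} h-quasi zero (g (map ι u) ∷ map ι w)
    (trans (sym (lift u w)) (trans (cong ι e) (lift u′ w)))

module _ (a : A) {G : Op (suc k + m) A}
         (G-quasi : IsQuasigroup (suc k + m) G) (G-cong : PrefixCongruent (suc k) G) where

  private
    c : Vec A m
    c = replicate _ a

    g : Op (suc k) A
    g u = G (u ++ c)

    g-quasi : IsQuasigroup (suc k) g
    g-quasi = isQuasigroup-++ˡ {p = suc k} {m = m} {G = G} G-quasi c

    prefix-surjective : ∀ w v → ∃[ u ] G (u ++ w) ≡ v
    prefix-surjective w = isQuasigroup⇒surjective {F = λ u → G (u ++ w)}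
      (isQuasigroup-++ˡ {p = suc k} {m = m} {G = G} G-quasi w) a

    section : A → Vec A (suc k)
    section z = proj₁ (prefix-surjective c z)

    g∘section : ∀ z → g (section z) ≡ z
    g∘section z = proj₂ (prefix-surjective c z)

    h : Op (suc m) A
    h (z ∷ w) = G (section z ++ w)

    h∘g : ∀ u w → h (g u ∷ w) ≡ G (u ++ w)
    h∘g u w = G-cong (section (g u)) u c w (g∘section (g u))

    h-quasi : IsQuasigroup (suc m) h
    h-quasi zero (_ ∷ w) v =
      (g u , trans (h∘g u w) Gu≡v) ,
      λ y y′ hy≡v hy′≡v → begin
        y                  ≡⟨ g∘section y ⟨
        g (section y)      ≡⟨ G-cong (section y) (section y′) w c (trans hy≡v (sym hy′≡v)) ⟩
        g (section y′)     ≡⟨ g∘section y′ ⟩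
        y′                 ∎
      where
      open ≡-Reasoning
      u = proj₁ (prefix-surjective w v)
      Gu≡v = proj₂ (prefix-surjective w v)
    h-quasi (suc j) (z ∷ w) =
      isQuasigroup-++ʳ {p = suc k} {m = m} {G = G} G-quasi (section z) j w

  prefixCongruent⇒decomposition : Decomposition (suc k) m G
  prefixCongruent⇒decomposition = g , h , g-quasi , h-quasi , λ ys →
    trans (cong G (sym (take++drop≡id (suc k) ys)))
          (sym (h∘g (take (suc k) ys) (drop (suc k) ys)))

lemma4 : ∀ {ℓ : Level} (Σ' Ω : Set ℓ) (ι : Ω → Σ') → Injective _≡_ _≡_ ι →
    Σ' → Ω → (n : ℕ) → (f : Op n Σ') → IsQuasigroup n f → Reducible n f →
    (fΩ : Op n Ω) → (∀ (xs : Vec Ω n) → ι (fΩ xs) ≡ f (map ι xs)) →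
    IsQuasigroup n fΩ → Reducible n fΩ
lemma4 _ Ω ι ι-inj _ ω n f _ (suc k , m , eq , 2≤k , 1≤m , σ , g , h , _ , h-quasi , f≡hg) fΩ ι∘fΩ fΩ-quasi =
  let gΩ , hΩ , gΩ-quasi , hΩ-quasi , G≡hg = decomposition
  in suc k , m , eq , 2≤k , 1≤m , σ , gΩ , hΩ , gΩ-quasi , hΩ-quasi ,
     λ xs → sym (reindex-transpose {H = fΩ} (flip π) (sym ∘ G≡hg) xs)
  where
  open ≡-Reasoning
  -- reindex π is the rearrangement xs ↦ (x_σ(cast j))_j of Reducible, and flip (flip π)
  -- computes back to π, so both directions of reindex-transpose apply definitionally.
  π : Permutation (suc k + m) n
  π = cast-id eq ∘ₚ σ

  G : Op (suc k + m) Ω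
  G = fΩ ∘ reindex (flip π)

  lift : ∀ u w → ι (G (u ++ w)) ≡ h (g (map ι u) ∷ map ι w)
  lift u w = begin
    ι (G (u ++ w))                             ≡⟨ ι∘fΩ _ ⟩
    f (map ι (reindex (flip π) (u ++ w)))      ≡⟨ cong f (map-reindex ι (flip π) (u ++ w)) ⟩
    f (reindex (flip π) (map ι (u ++ w)))      ≡⟨ cong (f ∘ reindex (flip π)) (map-++ ι u w) ⟩
    f (reindex (flip π) (map ι u ++ map ι w))  ≡⟨ decomposition-++ (suc k) {g = g} {h = h}
                                                    (reindex-transpose π f≡hg) (map ι u) (map ι w) ⟩
    h (g (map ι u) ∷ map ι w)                  ∎

  decomposition : Decomposition (suc k) m G
  decomposition = prefixCongruent⇒decomposition ω (isQuasigroup-reindex {F = fΩ} π fΩ-quasi)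
    (prefixCongruent-restrict ι ι-inj {G = G} g {h = h} h-quasi lift)
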